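{- Let $\alpha$ be a composition of $n$, $E\in\mathcal E(\alpha)$ and $T_0=T_{0,E}$ its source tableau. Let $T\in E$ with $T\ne T_0$ and $D(T)\subseteq D(T_0)$, and define $i=\max\{k\in[n]:T^{ -1}(k)\ne T_0^{ -1}(k)\}$ and $j=\min\{k\in[n]: k>i\text{ and } i\text{ attacks }k\text{ in }T_0\}$. Then $i$ and $j$ are well defined, and in $T$ the entry $i$ is located strictly left of every entry of $[i+1,j]$ (i.e. $c_T(i)<c_T(k)$ for all $k\in[i+1,j]$) and $i$ attacks no entry of $[i+1,j]$ in $T$.
   Context: A composition $\alpha=(\alpha_1,\dots,\alpha_l)$ of $n$ has diagram $\{(i,j):i\le l,j\le\alpha_i\}$ (matrix coordinates, row 1 on top). An SCT of shape $\alpha$ is a bijection $T$ from the diagram to $[n]$ with rows decreasing left to right, first column increasing top to bottom, and the triple rule: if $(j,k),(i,k-1)\in\alpha$, $j>i$, $T(j,k)<T(i,k-1)$, then $(i,k)\in\alpha$ and $T(j,k)<T(i,k)$. Let $c_T(k)$ be the column of $T^{ -1}(k)$ and $D(T)=\{i\in[n-1]:c_T(i)\le c_T(i+1)\}$. A cell $(i,j)$ attacks $(i',j')$ if $j=j'$ and $i\ne i'$, or $j=j'-1$ and $i<i'$; entry $a$ attacks $b$ in $T$ if $T^{ -1}(a)$ attacks $T^{ -1}(b)$. $T_1\sim T_2$ iff in each column the relative orders of entries coincide; $\mathcal E(\alpha)$ is the set of equivalence classes. The source tableau $T_{0,E}$ of $E$ is the unique $T\in E$ such that for every $i\in[n-1]\setminus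 D(T)$ the cell of $i+1$ is immediately to the left of the cell of $i$ in the same row. -}

module Defs where

open import Data.Nat using (ℕ; zero; suc; _≤_; _<_)
open import Data.List using (List; []; _∷_)
open import Data.Nat.ListAction using (sum)
open import Data.List.Relation.Unary.All using (All)
open import Data.Product using (_×_; _,_; proj₁; proj₂; ∃-syntax)
open import Data.Sum using (_⊎_)
open import Relation.Binary.PropositionalEquality using (_≡_; _≢_)
open import Relation.Nullary using (¬_)

IsComposition : List ℕ → Set
IsComposition α = All (λ a → 1 ≤ a) α

-- Cells are (row , column), 1-indexed, matrix coordinates (row 1 on top).
Cell : Set
Cell = ℕ × ℕ

row col : Cell → ℕ
row = proj₁
col = proj₂

-- length of row i (1-indexed); 0 for rows outside the composition (incl. row 0)
rowLen : List ℕ → ℕ → ℕ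
rowLen []       _             = 0
rowLen (a ∷ as) zero          = 0
rowLen (a ∷ as) (suc zero)    = a
rowLen (a ∷ as) (suc (suc i)) = rowLen as (suc i)

InDiag : List ℕ → Cell → Set
InDiag α (i , j) = 1 ≤ j × j ≤ rowLen α i

InRange : ℕ → ℕ → Set
InRange n k = 1 ≤ k × k ≤ n

-- A standard composition tableau of shape α, given by its inverse
-- pos k = T⁻¹(k) for k ∈ [n], n = sum α (values outside [n] are irrelevant).
record SCT (α : List ℕ) : Set where
  field
    pos      : ℕ → Cell
    pos-diag : ∀ k → InRange (sum α) k → InDiag α (pos k)
    pos-inj  : ∀ a b → InRange (sum α) a → InRange (sum α) b → pos a ≡ pos b → a ≡ b
    pos-surj : ∀ x → InDiag α x → ∃[ k ] (InRange (sum α) k × pos k ≡ x)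
    rows-dec : ∀ a b → InRange (sum α) a → InRange (sum α) b →
               row (pos a) ≡ row (pos b) → col (pos a) < col (pos b) → b < a
    col1-inc : ∀ a b → InRange (sum α) a → InRange (sum α) b →
               col (pos a) ≡ 1 → col (pos b) ≡ 1 → row (pos a) < row (pos b) → a < b
    -- triple rule: a = T(j,k), b = T(i,k-1), j > i, a < b  ⇒
    --   (i,k) ∈ α and T(j,k) < T(i,k)
    triple   : ∀ a b → InRange (sum α) a → InRange (sum α) b →
               col (pos a) ≡ suc (col (pos b)) → row (pos b) < row (pos a) → a < b →
               InDiag α (row (pos b) , col (pos a)) ×
               ∃[ c ] (InRange (sum α) c × pos c ≡ (row (pos b) , col (pos a)) × a < c)

open SCT public

cT : ∀ {α} → SCT α → ℕ → ℕ
cT T k = col (pos T k)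

InDes : ∀ {α} → SCT α → ℕ → Set
InDes T i = cT T i ≤ cT T (suc i)

DesSub : ∀ {α} → SCT α → SCT α → Set
DesSub {α} T T' = ∀ i → 1 ≤ i → suc i ≤ sum α → InDes T i → InDes T' i

CellAttacks : Cell → Cell → Set
CellAttacks (i , j) (i' , j') = (j ≡ j' × i ≢ i') ⊎ (suc j ≡ j' × i < i')

Attacks : ∀ {α} → SCT α → ℕ → ℕ → Set
Attacks T a b = CellAttacks (pos T a) (pos T b)

-- T₁ ∼ T₂ : in each column the relative orders of the entries coincide,
-- i.e. for cells x, y of the same column, T₁(x) < T₁(y) iff T₂(x) < T₂(y).
Equiv : ∀ {α} → SCT α → SCT α → Set
Equiv {α} T₁ T₂ = ∀ x y → InDiag α x → InDiag α y → col x ≡ col y →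
  ∀ a b a' b' → InRange (sum α) a → InRange (sum α) b →
  InRange (sum α) a' → InRange (sum α) b' →
  pos T₁ a ≡ x → pos T₁ b ≡ y → pos T₂ a' ≡ x → pos T₂ b' ≡ y →
  (a < b → a' < b') × (a' < b' → a < b)

-- T is a source tableau (of its class): for every i ∈ [n-1] \ D(T),
-- the cell of i+1 is immediately left of the cell of i in the same row.
IsSource : ∀ {α} → SCT α → Set
IsSource {α} T = ∀ i → 1 ≤ i → suc i ≤ sum α → ¬ InDes T i →
  row (pos T (suc i)) ≡ row (pos T i) × suc (cT T (suc i)) ≡ cT T i

SameTableau : ∀ {α} → SCT α → SCT α → Set
SameTableau {α} T T' = ∀ k → InRange (sum α) k → pos T k ≡ pos T' k

IsMaxDiff : ∀ {α} → SCT α → SCT α → ℕ → Set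
IsMaxDiff {α} T T' i = InRange (sum α) i × pos T i ≢ pos T' i ×
  (∀ k → i < k → k ≤ sum α → pos T k ≡ pos T' k)

IsMinAttacked : ∀ {α} → SCT α → ℕ → ℕ → Set
IsMinAttacked {α} T i j = InRange (sum α) j × i < j × Attacks T i j ×
  (∀ k → i < k → k < j → ¬ Attacks T i k)

-- Let i be the largest entry that T and the source tableau T₀ place differently, at (s , d) in T
-- and (r , c) in T₀.  Entries above i sit in the same cells in both tableaux, so the entry p of
-- T₀ at (s , d) is smaller than i, and column equivalence makes p the largest entry ≤ i of
-- column d in T₀.  Since a source tableau can only move left by one step along a row, reading
-- T₀ from p up to i never leaves the columns ≥ d, which gives d < c; by the same principle,
-- reading T₀ upwards from i + 1 (which lies in a column ≥ c, as D(T) ⊆ D(T₀)) never leaves the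
-- columns ≥ c until i attacks something.  The cell (r , c - 1) holds an entry b > i in T₀, so
-- this happens before b, and up to the first attacked entry j everything sits in columns ≥ c,
-- hence right of i in T.  An attack of i on k ≤ j in T would put k in column d + 1 = c below
-- row s; below row r the triple rule in T₀ applied to k and b forbids it, and between rows s and
-- r the triple rule in T together with column equivalence does.
module Submission where

open import Defs
open import Data.Nat using (ℕ; zero; suc; pred; _<_; _≤_; z≤n; s≤s; z<s; >-nonZero; _≟_; _≤?_; _<?_)
open import Data.Nat.Properties
open import Data.Nat.ListAction using (sum)
open import Data.List using (List)
open import Data.Product using (_×_; ∃-syntax; _,_; proj₁; proj₂; swap)
open import Data.Product.Properties using (≡-dec)
open import Data.Sum using (_⊎_; inj₁; inj₂)
open import Function using (_∘_)
open import Relation.Binary.Definitions using (tri<; tri≈; tri>)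
open import Relation.Binary.PropositionalEquality using (_≡_; _≢_; refl; sym; trans; cong; cong₂; subst)
open import Relation.Nullary using (¬_; Dec; yes; no; contradiction)
open import Relation.Nullary.Decidable using (_×-dec_; _⊎-dec_; ¬?)
open import Relation.Unary using (Decidable)

interval-induction : ∀ (P : ℕ → Set) {a b} → P a → (∀ k → a ≤ k → k < b → P k → P (suc k)) →
  ∀ k → a ≤ k → k ≤ b → P k
interval-induction P Pa step zero a≤0 _ = subst P (n≤0⇒n≡0 a≤0) Pa
interval-induction P Pa step (suc k) a≤k+1 k+1≤b with m≤n⇒m<n∨m≡n a≤k+1
... | inj₂ refl = Pa
... | inj₁ a≤k  = step k (≤-pred a≤k) k+1≤b
                    (interval-induction P Pa step k (≤-pred a≤k) (<⇒≤ k+1≤b))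

extend-to-suc : ∀ {P : ℕ → Set} {N k} → P (suc N) → (k ≤ N → P k) → k ≤ suc N → P k
extend-to-suc P[N+1] below k≤N+1 with m≤n⇒m<n∨m≡n k≤N+1
... | inj₁ k≤N  = below (≤-pred k≤N)
... | inj₂ refl = P[N+1]

greatest-failure : ∀ {P : ℕ → Set} → Decidable P → ∀ N →
  (∀ k → InRange N k → P k) ⊎
  ∃[ k ] (InRange N k × ¬ P k × (∀ k' → k < k' → k' ≤ N → P k'))
greatest-failure P? zero = inj₁ λ k (1≤k , k≤0) → contradiction (≤-trans 1≤k k≤0) λ ()
greatest-failure {P} P? (suc N) with P? (suc N)
... | no ¬P =
      inj₂ (suc N , (s≤s z≤n , ≤-refl) , ¬P , λ k' N<k' k'≤N → contradiction k'≤N (<⇒≱ N<k'))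
... | yes P[N+1] with greatest-failure P? N
...   | inj₁ all =
        inj₁ λ k (1≤k , k≤N+1) → extend-to-suc {P} P[N+1] (λ k≤N → all k (1≤k , k≤N)) k≤N+1
...   | inj₂ (k , (1≤k , k≤N) , ¬P , above) =
        inj₂ (k , (1≤k , m≤n⇒m≤1+n k≤N) , ¬P ,
              λ k' k<k' → extend-to-suc {P} P[N+1] (above k' k<k'))

least-above : ∀ {P : ℕ → Set} → Decidable P → ∀ lo N →
  (∀ k → lo < k → k ≤ N → ¬ P k) ⊎
  ∃[ j ] (lo < j × j ≤ N × P j × (∀ k → lo < k → k < j → ¬ P k))
least-above P? lo zero = inj₁ λ k lo<k k≤0 → contradiction (<-≤-trans z<s lo<k) (<⇒≱ (s≤s k≤0))
least-above {P} P? lo (suc N) with least-above P? lo N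
... | inj₂ (j , lo<j , j≤N , Pj , below) = inj₂ (j , lo<j , m≤n⇒m≤1+n j≤N , Pj , below)
... | inj₁ none with P? (suc N) | lo <? suc N
...   | yes P[N+1] | yes lo<N+1 =
        inj₂ (suc N , lo<N+1 , ≤-refl , P[N+1] , λ k lo<k k≤N → none k lo<k (≤-pred k≤N))
...   | yes _      | no lo≮N+1 = inj₁ λ k lo<k k≤N+1 _ → lo≮N+1 (<-≤-trans lo<k k≤N+1)
...   | no ¬P[N+1] | _ = inj₁ λ k lo<k → extend-to-suc {¬_ ∘ P} ¬P[N+1] (none k lo<k)

cellAttacks? : (u v : Cell) → Dec (CellAttacks u v)
cellAttacks? (a , b) (a' , b') = ((b ≟ b') ×-dec ¬? (a ≟ a')) ⊎-dec ((suc b ≟ b') ×-dec (a <? a'))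

Equiv-sym : ∀ {α} {T₁ T₂ : SCT α} → Equiv T₁ T₂ → Equiv T₂ T₁
Equiv-sym equiv x y x∈ y∈ cx≡cy a b a' b' aR bR a'R b'R a-at b-at a'-at b'-at =
  swap (equiv x y x∈ y∈ cx≡cy a' b' a b a'R b'R aR bR a'-at b'-at a-at b-at)

module _ {α : List ℕ} (T : SCT α) where

  column-attacks : ∀ {a b} → InRange (sum α) a → InRange (sum α) b → a ≢ b →
    cT T a ≡ cT T b → Attacks T a b
  column-attacks {a} {b} aR bR a≢b ca≡cb = inj₁ (ca≡cb , a≢b ∘ same-cell)
    where
    same-cell : row (pos T a) ≡ row (pos T b) → a ≡ b
    same-cell ra≡rb = pos-inj T _ _ aR bR (cong₂ _,_ ra≡rb ca≡cb)

  source-col-drop : IsSource T → ∀ {t k} → 1 ≤ k → suc k ≤ sum α →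
    t ≤ cT T k → cT T (suc k) < t → cT T k ≡ t × row (pos T (suc k)) ≡ row (pos T k)
  source-col-drop source {t} {k} 1≤k k+1≤n t≤ck ck+1<t with cT T k ≤? cT T (suc k)
  ... | yes ck≤ck+1 = contradiction (≤-trans t≤ck ck≤ck+1) (<⇒≱ ck+1<t)
  ... | no ck≰ck+1 with source k 1≤k k+1≤n ck≰ck+1
  ...   | same-row , ck+1+1≡ck =
          ≤-antisym (subst (_≤ t) ck+1+1≡ck ck+1<t) t≤ck , same-row

module Agreeing {α : List ℕ} (T T' : SCT α) (equiv : Equiv T' T)
  {i : ℕ} (iR : InRange (sum α) i) (differ : pos T i ≢ pos T' i)
  (agree : ∀ k → i < k → k ≤ sum α → pos T k ≡ pos T' k) where

  agree-inj : ∀ {a b} → InRange (sum α) a → InRange (sum α) b → i < a →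
    pos T a ≡ pos T' b → a ≡ b
  agree-inj aR bR i<a a≡b = pos-inj T' _ _ aR bR (trans (sym (agree _ i<a (proj₂ aR))) a≡b)

  displaced : ∀ {q} → InRange (sum α) q → pos T' q ≡ pos T i → q < i
  displaced {q} qR q-at with <-cmp q i
  ... | tri< q<i _ _ = q<i
  ... | tri≈ _ refl _ = contradiction (sym q-at) differ
  ... | tri> _ _ i<q =
          contradiction (pos-inj T q i qR iR (trans (agree q i<q (proj₂ qR)) q-at)) (>⇒≢ i<q)

  left-of-i : ∀ {k} → InRange (sum α) k → row (pos T' k) ≡ row (pos T i) →
    cT T' k < cT T i → i < k
  left-of-i {k} kR same-row left with pos-surj T (pos T' k) (pos-diag T' k kR)
  ... | a , aR , a-at = subst (i <_) (agree-inj aR kR i<a a-at) i<a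
    where
    i<a : i < a
    i<a = rows-dec T a i aR iR (trans (cong row a-at) same-row)
                   (subst (_< cT T i) (sym (cong col a-at)) left)

  column-transfer : ∀ {q k} → InRange (sum α) q → InRange (sum α) k → pos T' q ≡ pos T i →
    cT T' k ≡ cT T i → q < k → i < k
  column-transfer {q} {k} qR kR q-at same-col q<k with pos-surj T (pos T' k) (pos-diag T' k kR)
  ... | a , aR , a-at = subst (i <_) (agree-inj aR kR i<a a-at) i<a
    where
    i<a : i < a
    i<a = proj₁ (equiv (pos T i) (pos T' k) (pos-diag T i iR) (pos-diag T' k kR) (sym same-col)
                   q k i a qR kR iR aR q-at refl refl a-at) q<k

module _ {α : List ℕ} (T₀ : SCT α) (source : IsSource T₀) (T : SCT α) (equiv : Equiv T T₀)
  (des : DesSub T T₀) {i : ℕ} (iR : InRange (sum α) i) (differ : pos T i ≢ pos T₀ i)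
  (agree : ∀ k → i < k → k ≤ sum α → pos T k ≡ pos T₀ k) where

  private
    n : ℕ
    n = sum α

    module A  = Agreeing T T₀ (Equiv-sym {α} {T} {T₀} equiv) iR differ agree
    module A₀ = Agreeing T₀ T equiv iR (differ ∘ sym) (λ k i<k k≤n → sym (agree k i<k k≤n))

    r c s d : ℕ
    r = row (pos T₀ i)
    c = cT T₀ i
    s = row (pos T i)
    d = cT T i

    p : ℕ
    p = proj₁ (pos-surj T₀ (pos T i) (pos-diag T i iR))

    pR : InRange n p
    pR = proj₁ (proj₂ (pos-surj T₀ (pos T i) (pos-diag T i iR)))

    p-at : pos T₀ p ≡ pos T i
    p-at = proj₂ (proj₂ (pos-surj T₀ (pos T i) (pos-diag T i iR)))

    p<i : p < i
    p<i = A.displaced pR p-at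

  column-d-up-to-i-ends-at-p : ∀ {k} → InRange n k → k ≤ i → cT T₀ k ≡ d → k ≤ p
  column-d-up-to-i-ends-at-p kR k≤i ck≡d =
    ≮⇒≥ λ p<k → <⇒≱ (A.column-transfer pR kR p-at ck≡d p<k) k≤i

  d≤cT₀-from-p-to-i : ∀ k → p ≤ k → k ≤ i → d ≤ cT T₀ k
  d≤cT₀-from-p-to-i =
    interval-induction (λ k → d ≤ cT T₀ k) (≤-reflexive (cong col (sym p-at))) step
    where
    step : ∀ k → p ≤ k → k < i → d ≤ cT T₀ k → d ≤ cT T₀ (suc k)
    step k p≤k k<i d≤ck with d ≤? cT T₀ (suc k)
    ... | yes d≤ck+1 = d≤ck+1
    ... | no d≰ck+1 = contradiction k<i (<⇒≱ (A.left-of-i k+1R same-row (≰⇒> d≰ck+1)))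
      where
      kR : InRange n k
      kR = ≤-trans (proj₁ pR) p≤k , ≤-trans (n≤1+n k) (≤-trans k<i (proj₂ iR))
      k+1R : InRange n (suc k)
      k+1R = s≤s z≤n , ≤-trans k<i (proj₂ iR)
      drop : cT T₀ k ≡ d × row (pos T₀ (suc k)) ≡ row (pos T₀ k)
      drop = source-col-drop T₀ source (proj₁ kR) (proj₂ k+1R) d≤ck (≰⇒> d≰ck+1)
      k≡p : k ≡ p
      k≡p = ≤-antisym (column-d-up-to-i-ends-at-p kR (<⇒≤ k<i) (proj₁ drop)) p≤k
      same-row : row (pos T₀ (suc k)) ≡ s
      same-row = trans (proj₂ drop) (trans (cong (row ∘ pos T₀) k≡p) (cong row p-at))

  d<c : d < c
  d<c = ≤∧≢⇒< (d≤cT₀-from-p-to-i i (<⇒≤ p<i) ≤-refl)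
               (λ d≡c → <⇒≱ p<i (column-d-up-to-i-ends-at-p iR ≤-refl (sym d≡c)))

  private
    c-1+1≡c : suc (pred c) ≡ c
    c-1+1≡c = suc-pred c {{>-nonZero (proj₁ (pos-diag T₀ i iR))}}

    c-1<c : pred c < c
    c-1<c = ≤-reflexive c-1+1≡c

    cell-left-of-i : InDiag α (r , pred c)
    cell-left-of-i = ≤-trans (proj₁ (pos-diag T i iR)) (pred-mono-≤ d<c)
                   , ≤-trans (<⇒≤ c-1<c) (proj₂ (pos-diag T₀ i iR))

    b : ℕ
    b = proj₁ (pos-surj T₀ (r , pred c) cell-left-of-i)

    bR : InRange n b
    bR = proj₁ (proj₂ (pos-surj T₀ (r , pred c) cell-left-of-i))

    b-at : pos T₀ b ≡ (r , pred c)
    b-at = proj₂ (proj₂ (pos-surj T₀ (r , pred c) cell-left-of-i))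

    cb<c : cT T₀ b < c
    cb<c = subst (_< c) (sym (cong col b-at)) c-1<c

  i<b : i < b
  i<b = rows-dec T₀ b i bR iR (cong row b-at) cb<c

  i∈D[T₀] : InDes T₀ i
  i∈D[T₀] with c ≤? cT T₀ (suc i)
  ... | yes c≤ci+1 = c≤ci+1
  ... | no c≰ci+1 = contradiction (des i (proj₁ iR) i+1≤n i∈D[T]) c≰ci+1
    where
    i+1≤n : suc i ≤ n
    i+1≤n = ≤-trans i<b (proj₂ bR)
    i∈D[T] : InDes T i
    i∈D[T] = subst (d ≤_) (cong col (sym (agree (suc i) ≤-refl i+1≤n)))
               (≤-pred (subst (d <_) (sym (proj₂ (source i (proj₁ iR) i+1≤n c≰ci+1))) d<c))

  c≤cT₀-until-attack : ∀ {u} → u ≤ n → (∀ k → i < k → k < u → ¬ Attacks T₀ i k) →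
    ∀ k → i < k → k ≤ u → c ≤ cT T₀ k
  c≤cT₀-until-attack {u} u≤n no-attack = interval-induction (λ k → c ≤ cT T₀ k) i∈D[T₀] step
    where
    step : ∀ k → i < k → k < u → c ≤ cT T₀ k → c ≤ cT T₀ (suc k)
    step k i<k k<u c≤ck with c ≤? cT T₀ (suc k)
    ... | yes c≤ck+1 = c≤ck+1
    ... | no c≰ck+1 =
          contradiction (column-attacks T₀ iR kR (<⇒≢ i<k) (sym ck≡c)) (no-attack k i<k k<u)
      where
      kR : InRange n k
      kR = ≤-trans (s≤s z≤n) i<k , ≤-trans (<⇒≤ k<u) u≤n
      ck≡c : cT T₀ k ≡ c
      ck≡c = proj₁ (source-col-drop T₀ source (proj₁ kR) (≤-trans k<u u≤n)
                                    c≤ck (≰⇒> c≰ck+1))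

  i-attacks-before-b : ¬ (∀ k → i < k → k < b → ¬ Attacks T₀ i k)
  i-attacks-before-b no-attack = <⇒≱ cb<c (c≤cT₀-until-attack (proj₂ bR) no-attack b i<b ≤-refl)

  column-c-up-to-b-lies-above-i : ∀ {k} → InRange n k → i < k → k ≤ b → cT T₀ k ≡ c →
    row (pos T₀ k) < r
  column-c-up-to-b-lies-above-i {k} kR i<k k≤b ck≡c with <-cmp (row (pos T₀ k)) r
  ... | tri< above _ _ = above
  ... | tri≈ _ same-row _ = contradiction (pos-inj T₀ k i kR iR (cong₂ _,_ same-row ck≡c)) (>⇒≢ i<k)
  ... | tri> _ _ below
        with triple T₀ k b kR bR ck≡cb+1 (subst (_< row (pos T₀ k)) (sym (cong row b-at)) below) k<b
    where
    k<b : k < b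
    k<b = ≤∧≢⇒< k≤b λ k≡b → <⇒≢ cb<c (trans (cong (cT T₀) (sym k≡b)) ck≡c)
    ck≡cb+1 : cT T₀ k ≡ suc (cT T₀ b)
    ck≡cb+1 = trans ck≡c (sym (trans (cong (suc ∘ col) b-at) c-1+1≡c))
  ...   | _ , e , eR , e-at , k<e = contradiction (<-trans i<k k<e) (<-irrefl (sym e≡i))
    where
    e≡i : e ≡ i
    e≡i = pos-inj T₀ e i eR iR (trans e-at (cong₂ _,_ (cong row b-at) ck≡c))

  s≮r-if-adjacent : suc d ≡ c → ¬ s < r
  s≮r-if-adjacent d+1≡c s<r with pos-surj T (pos T₀ i) (pos-diag T₀ i iR)
  ... | q , qR , q-at
        with triple T q i qR iR (trans (cong col q-at) (sym d+1≡c))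
                    (subst (s <_) (sym (cong row q-at)) s<r) (A₀.displaced qR q-at)
  ... | _ , e , eR , e-at , q<e = <-asym e<i i<e
    where
    ce≡c : cT T e ≡ c
    ce≡c = trans (cong col e-at) (cong col q-at)
    i<e : i < e
    i<e = A₀.column-transfer qR eR q-at ce≡c q<e
    e<i : e < i
    e<i = rows-dec T i e iR eR (sym (cong row e-at)) (subst (d <_) (sym ce≡c) d<c)

  first-attacked-after-i : ∃[ j ] IsMinAttacked T₀ i j
  first-attacked-after-i with least-above (λ k → cellAttacks? (pos T₀ i) (pos T₀ k)) i n
  ... | inj₁ none =
          contradiction (λ k i<k k<b → none k i<k (≤-trans (<⇒≤ k<b) (proj₂ bR))) i-attacks-before-b
  ... | inj₂ (j , i<j , j≤n , attacked , first) =
          j , (≤-trans (s≤s z≤n) i<j , j≤n) , i<j , attacked , first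

  right-of-i-and-unattacked : ∀ {j} → IsMinAttacked T₀ i j →
    ∀ k → i < k → k ≤ j → cT T i < cT T k × ¬ Attacks T i k
  right-of-i-and-unattacked {j} ((_ , j≤n) , _ , _ , first) k i<k k≤j = d<ck , unattacked
    where
    j≤b : j ≤ b
    j≤b = ≮⇒≥ λ b<j → i-attacks-before-b (λ k' i<k' k'<b → first k' i<k' (<-trans k'<b b<j))
    kR : InRange n k
    kR = ≤-trans (s≤s z≤n) i<k , ≤-trans k≤j j≤n
    k-unmoved : pos T k ≡ pos T₀ k
    k-unmoved = agree k i<k (proj₂ kR)
    c≤ck : c ≤ cT T₀ k
    c≤ck = c≤cT₀-until-attack j≤n first k i<k k≤j
    d<ck : d < cT T k
    d<ck = subst (d <_) (sym (cong col k-unmoved)) (<-≤-trans d<c c≤ck)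
    unattacked : ¬ Attacks T i k
    unattacked (inj₁ (d≡ck , _)) = <⇒≢ d<ck d≡ck
    unattacked (inj₂ (d+1≡ck , s<rk)) =
      s≮r-if-adjacent d+1≡c (<-trans (subst (s <_) (cong row k-unmoved) s<rk)
                                     (column-c-up-to-b-lies-above-i kR i<k (≤-trans k≤j j≤b) ck≡c))
      where
      ck≡c : cT T₀ k ≡ c
      ck≡c = ≤-antisym (subst (_≤ c) (trans d+1≡ck (cong col k-unmoved)) d<c) c≤ck
      d+1≡c : suc d ≡ c
      d+1≡c = trans d+1≡ck (trans (cong col k-unmoved) ck≡c)

lemma4p7 : (α : List ℕ) → IsComposition α →
    (T₀ : SCT α) → IsSource T₀ →
    (T : SCT α) → Equiv T T₀ → ¬ SameTableau T T₀ → DesSub T T₀ →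
    ∃[ i ] (IsMaxDiff T T₀ i × ∃[ j ] (IsMinAttacked T₀ i j ×
      (∀ k → i < k → k ≤ j → cT T i < cT T k × ¬ Attacks T i k)))
lemma4p7 α _ T₀ source T equiv T≠T₀ des
  with greatest-failure (λ k → ≡-dec _≟_ _≟_ (pos T k) (pos T₀ k)) (sum α)
... | inj₁ T≡T₀ = contradiction T≡T₀ T≠T₀
... | inj₂ (i , iR , differ , agree) with first-attacked-after-i T₀ source T equiv des iR differ agree
...   | j , j-first = i , (iR , differ , agree) , j , j-first ,
                      right-of-i-and-unattacked T₀ source T equiv des iR differ agree j-first
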